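{- Let $n=p^m$ where $p$ is a prime and $m>1$ is an integer. Then the Laplacian eigenvalues of the comaximal graph $\Gamma(\mathbb{Z}_n)$ are $n$ with multiplicity $\phi(n)$, $\phi(n)$ with multiplicity $n-\phi(n)-1$, and $0$ with multiplicity $1$.
   Context: The comaximal graph $\Gamma(\mathbb{Z}_n)$ has vertex set $\mathbb{Z}_n=\{0,1,\dots,n-1\}$, distinct $x,y$ adjacent iff $\langle x\rangle+\langle y\rangle=\mathbb{Z}_n$. Its Laplacian matrix is $L=D-A$ ($D$ diagonal degree matrix, $A$ adjacency matrix). $\phi$ is Euler's totient function. -}

module Defs where

open import Data.Nat as ℕ using (ℕ; zero; suc; _%_; _≟_)
open import Data.Nat.GCD using (gcd)
open import Data.Integer as ℤ using (ℤ; +_; _-_; _*_; _+_; -_)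
open import Data.Fin using (Fin; toℕ; punchIn)
import Data.Fin as F
open import Data.Fin.Properties using (any?)
open import Data.Product using (Σ; _×_)
open import Data.List using (List; length; filter; upTo)
open import Data.Bool using (Bool; true; false; if_then_else_; _∧_; not)
open import Relation.Nullary using (¬_; does)
open import Relation.Nullary.Decidable using (¬?; _×-dec_)
open import Relation.Binary.PropositionalEquality using (_≡_)

φ : ℕ → ℕ
φ n = length (filter (λ j → gcd (suc j) n ≟ 1) (upTo n))

Σℤ : (n : ℕ) → (Fin n → ℤ) → ℤ
Σℤ zero    f = + 0
Σℤ (suc n) f = f F.zero + Σℤ n (λ j → f (F.suc j))

Matrix : ℕ → Set
Matrix n = Fin n → Fin n → ℤ

sgn : ℕ → ℤ
sgn zero = + 1
sgn (suc j) = - sgn j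

det : (n : ℕ) → Matrix n → ℤ
det zero    M = + 1
det (suc n) M = Σℤ (suc n) (λ j → sgn (toℕ j) * M F.zero j * det n (λ r c → M (F.suc r) (punchIn j c)))

-- Characteristic polynomial χ_M(x) = det(x I - M), evaluated at an integer x
charPoly : (n : ℕ) → Matrix n → ℤ → ℤ
charPoly n M x = det n (λ i j → (if does (i F.≟ j) then x else + 0) - M i j)

-- The ring ℤ_N with N = suc k: elements are Fin (suc k), represented by 0..k.
-- Principal ideals ⟨x⟩ + ⟨y⟩ = ℤ_N iff 1 ∈ ⟨x⟩ + ⟨y⟩ iff ∃ a b ∈ ℤ_N, a x + b y = 1 in ℤ_N.
Comaximal : (k : ℕ) → Fin (suc k) → Fin (suc k) → Set
Comaximal k x y = Σ (Fin (suc k)) λ a → Σ (Fin (suc k)) λ b →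
  (toℕ a ℕ.* toℕ x ℕ.+ toℕ b ℕ.* toℕ y) % suc k ≡ 1 % suc k

Adj : (k : ℕ) → Fin (suc k) → Fin (suc k) → Set
Adj k x y = (¬ (x ≡ y)) × Comaximal k x y

adj? : (k : ℕ) → (x y : Fin (suc k)) → Bool
adj? k x y = does {A = Adj k x y} (¬? (x F.≟ y) ×-dec
  any? (λ a → any? (λ b → (toℕ a ℕ.* toℕ x ℕ.+ toℕ b ℕ.* toℕ y) % suc k ≟ 1 % suc k)))

adjMatrix : (k : ℕ) → Matrix (suc k)
adjMatrix k x y = if adj? k x y then + 1 else + 0

degree : (k : ℕ) → Fin (suc k) → ℤ
degree k x = Σℤ (suc k) (adjMatrix k x)

laplacian : (k : ℕ) → Matrix (suc k)
laplacian k i j = (if does (i F.≟ j) then degree k i else + 0) - adjMatrix k i j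

-- In ℤ_(p^m) an element is a unit iff p does not divide it, and two elements generate the
-- whole ring iff one of them is a unit.  So Γ(ℤ_n) is a complete split graph: the φ(n) units
-- are adjacent to every other vertex, the n − φ(n) nonunits only to the units.  With w the
-- indicator of the nonunits, xI − L = D + J − w wᵀ where D is diagonal and constant on each
-- class.  Subtracting from every row the row of 0 (a nonunit) or of 1 (a unit), according to
-- its class, leaves multiples of e_i − e_0 or e_i − e_1; using these rows to clear the other
-- columns of rows 0 and 1 reduces the determinant to (x − n)^(φ−1) (x − φ)^(n−φ−1) times a
-- 2×2 determinant, which equals x (x − n).

module Submission where

open import Defs
open import Data.Bool using (Bool; true; false; if_then_else_; _∧_; not)
open import Data.Empty using (⊥; ⊥-elim)
open import Data.Fin as F using (Fin; toℕ; punchIn; punchOut)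
import Data.Fin.Properties as FP
open import Data.Integer as ℤ using (ℤ; +_; -[1+_]; _+_; _-_; _*_; -_)
import Data.Integer.Properties as ℤP
import Data.Nat.Properties as ℕP
open import Data.Integer.Tactic.RingSolver using (solve-∀)
open import Data.Nat as ℕ using (ℕ; zero; suc; _<_; _^_; _∸_; _%_; nonTrivial⇒≢1)
open import Data.Nat.Coprimality using (Coprime; coprime-divisor; coprime⇒gcd≡1; coprime-Bézout)
open import Data.Nat.DivMod using (m%n<n; m%n%n≡m%n; %-distribˡ-*; [m+n]%n≡m%n; [m+kn]%n≡m%n)
open import Data.Nat.Divisibility
  using (_∣_; _∣?_; _∣0; ∣1⇒≡1; ∣-trans; m∣m*n; ∣n⇒∣m*n; ∣m∣n⇒∣m+n; %-presˡ-∣; ∣n∣m%n⇒∣m)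
open import Data.Nat.GCD using (gcd; gcd-greatest; gcd-zeroˡ; module Bézout)
open import Data.Nat.Primality using (Prime; prime⇒irreducible; prime⇒nonTrivial)
import Data.Nat.Tactic.RingSolver as ℕSolver
open import Data.List using (length; filter; applyUpTo; upTo; _++_; [_]; [])
open import Data.List.Properties using (length-++; filter-++; filter-accept; filter-reject; upTo-∷ʳ)
open import Data.Product using (Σ; _×_; _,_; proj₁; proj₂)
open import Data.Sum using (_⊎_; inj₁; inj₂)
open import Function using (_∘_; flip)
open import Data.Vec.Functional using (_∷_)
open import Relation.Binary.PropositionalEquality
  using (_≡_; _≢_; refl; sym; trans; cong; cong₂; subst; module ≡-Reasoning)
open import Relation.Nullary using (¬_; Dec; yes; no; does)
open import Relation.Nullary.Decidable using (dec-true; dec-false)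
open import Relation.Unary using (Decidable)
open import Relation.Nullary.Reflects using (ofʸ; ofⁿ)

open import Algebra.Properties.CommutativeSemigroup ℤP.+-commutativeSemigroup
  using () renaming (interchange to +-interchange; x∙yz≈y∙xz to x+[y+z]≡y+[x+z])
open import Algebra.Properties.CommutativeSemigroup ℤP.*-commutativeSemigroup
  using () renaming (x∙yz≈y∙xz to x*[y*z]≡y*[x*z])

open ≡-Reasoning

pattern 0F = F.zero
pattern 1F = F.suc F.zero
pattern 2+ i = F.suc (F.suc i)

Σℤ-cong : ∀ n {f g : Fin n → ℤ} → (∀ i → f i ≡ g i) → Σℤ n f ≡ Σℤ n g
Σℤ-cong zero    f≗g = refl
Σℤ-cong (suc n) f≗g = cong₂ _+_ (f≗g 0F) (Σℤ-cong n (f≗g ∘ F.suc))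

Σℤ-zero : ∀ n {f : Fin n → ℤ} → (∀ i → f i ≡ + 0) → Σℤ n f ≡ + 0
Σℤ-zero zero    f≗0 = refl
Σℤ-zero (suc n) f≗0 = cong₂ _+_ (f≗0 0F) (Σℤ-zero n (f≗0 ∘ F.suc))

Σℤ-+ : ∀ n (f g : Fin n → ℤ) → Σℤ n (λ i → f i + g i) ≡ Σℤ n f + Σℤ n g
Σℤ-+ zero    f g = refl
Σℤ-+ (suc n) f g = trans (cong (_+_ (f 0F + g 0F)) (Σℤ-+ n (f ∘ F.suc) (g ∘ F.suc)))
                         (+-interchange (f 0F) (g 0F) _ _)

Σℤ-*ˡ : ∀ n (c : ℤ) (f : Fin n → ℤ) → Σℤ n (λ i → c * f i) ≡ c * Σℤ n f
Σℤ-*ˡ zero    c f = sym (ℤP.*-zeroʳ c)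
Σℤ-*ˡ (suc n) c f = trans (cong (_+_ (c * f 0F)) (Σℤ-*ˡ n c (f ∘ F.suc)))
                          (sym (ℤP.*-distribˡ-+ c (f 0F) _))

Σℤ-neg : ∀ n (f : Fin n → ℤ) → Σℤ n (λ i → - f i) ≡ - Σℤ n f
Σℤ-neg zero    f = refl
Σℤ-neg (suc n) f = trans (cong (_+_ (- f 0F)) (Σℤ-neg n (f ∘ F.suc)))
                         (sym (ℤP.neg-distrib-+ (f 0F) _))

Σℤ-comm : ∀ n m (f : Fin n → Fin m → ℤ) →
          Σℤ n (λ i → Σℤ m (f i)) ≡ Σℤ m (λ j → Σℤ n (λ i → f i j))
Σℤ-comm zero    m f = sym (Σℤ-zero m (λ _ → refl))
Σℤ-comm (suc n) m f = trans (cong (_+_ (Σℤ m (f 0F))) (Σℤ-comm n m (f ∘ F.suc)))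
                            (sym (Σℤ-+ m (f 0F) _))

Σℤ-punchIn : ∀ n (a : Fin (suc n)) (f : Fin (suc n) → ℤ) →
             Σℤ (suc n) f ≡ f a + Σℤ n (f ∘ punchIn a)
Σℤ-punchIn n       0F        f = refl
Σℤ-punchIn (suc n) (F.suc a) f =
  trans (cong (_+_ (f 0F)) (Σℤ-punchIn n a (f ∘ F.suc))) (x+[y+z]≡y+[x+z] (f 0F) (f (F.suc a)) _)

minor : ∀ {n} → Fin (suc n) → Matrix (suc n) → Matrix n
minor j M r c = M (F.suc r) (punchIn j c)

laplaceTerm : ∀ n → Matrix (suc n) → Fin (suc n) → ℤ
laplaceTerm n M j = sgn (toℕ j) * M 0F j * det n (minor j M)

det-cong : ∀ n {M N : Matrix n} → (∀ i j → M i j ≡ N i j) → det n M ≡ det n N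
det-cong zero    M≡N = refl
det-cong (suc n) M≡N = Σℤ-cong (suc n) λ j →
  cong₂ (λ m d → sgn (toℕ j) * m * d) (M≡N 0F j) (det-cong n (λ r c → M≡N (F.suc r) (punchIn j c)))

det-by-laplaceTerms : ∀ n (a b : ℤ) {L M N : Matrix (suc n)} →
                      (∀ j → laplaceTerm n L j ≡ a * laplaceTerm n M j + b * laplaceTerm n N j) →
                      det (suc n) L ≡ a * det (suc n) M + b * det (suc n) N
det-by-laplaceTerms n a b {L} {M} {N} terms = begin
    Σℤ (suc n) (laplaceTerm n L)
  ≡⟨ Σℤ-cong (suc n) terms ⟩
    Σℤ (suc n) (λ j → a * laplaceTerm n M j + b * laplaceTerm n N j)
  ≡⟨ Σℤ-+ (suc n) (λ j → a * laplaceTerm n M j) (λ j → b * laplaceTerm n N j) ⟩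
    Σℤ (suc n) (λ j → a * laplaceTerm n M j) + Σℤ (suc n) (λ j → b * laplaceTerm n N j)
  ≡⟨ cong₂ _+_ (Σℤ-*ˡ (suc n) a (laplaceTerm n M)) (Σℤ-*ˡ (suc n) b (laplaceTerm n N)) ⟩
    a * det (suc n) M + b * det (suc n) N ∎

det-linear-row : ∀ n (r : Fin n) (a b : ℤ) {L M N : Matrix n} →
                 (∀ i → i ≢ r → ∀ j → L i j ≡ M i j) →
                 (∀ i → i ≢ r → ∀ j → L i j ≡ N i j) →
                 (∀ j → L r j ≡ a * M r j + b * N r j) →
                 det n L ≡ a * det n M + b * det n N
det-linear-row (suc n) 0F a b {L} {M} {N} L≡M L≡N Lr = det-by-laplaceTerms n a b {L} {M} {N} λ j → begin
    sgn (toℕ j) * L 0F j * det n (minor j L)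
  ≡⟨ cong₂ (λ l d → sgn (toℕ j) * l * d) (Lr j) (det-cong n (minors≡ L≡M j)) ⟩
    sgn (toℕ j) * (a * M 0F j + b * N 0F j) * det n (minor j M)
  ≡⟨ distribute (sgn (toℕ j)) a b (M 0F j) (N 0F j) _ ⟩
    a * laplaceTerm n M j + b * (sgn (toℕ j) * N 0F j * det n (minor j M))
  ≡⟨ cong (λ d → a * laplaceTerm n M j + b * (sgn (toℕ j) * N 0F j * d))
          (det-cong n (λ r c → trans (sym (minors≡ L≡M j r c)) (minors≡ L≡N j r c))) ⟩
    a * laplaceTerm n M j + b * laplaceTerm n N j ∎
  where
  minors≡ : ∀ {K} → (∀ i → i ≢ 0F → ∀ j → L i j ≡ K i j) → ∀ j r c → minor j L r c ≡ minor j K r c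
  minors≡ L≡K j r c = L≡K (F.suc r) (λ ()) (punchIn j c)
  distribute : ∀ s a b x y d → s * (a * x + b * y) * d ≡ a * (s * x * d) + b * (s * y * d)
  distribute = solve-∀
det-linear-row (suc n) (F.suc r) a b {L} {M} {N} L≡M L≡N Lr = det-by-laplaceTerms n a b {L} {M} {N} λ j → begin
    sgn (toℕ j) * L 0F j * det n (minor j L)
  ≡⟨ cong₂ (λ l d → sgn (toℕ j) * l * d) (L≡M 0F (λ ()) j)
       (det-linear-row n r a b (minors≡ L≡M j) (minors≡ L≡N j) (λ c → Lr (punchIn j c))) ⟩
    sgn (toℕ j) * M 0F j * (a * det n (minor j M) + b * det n (minor j N))
  ≡⟨ distribute (sgn (toℕ j)) a b (M 0F j) _ _ ⟩
    a * laplaceTerm n M j + b * (sgn (toℕ j) * M 0F j * det n (minor j N))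
  ≡⟨ cong (λ m → a * laplaceTerm n M j + b * (sgn (toℕ j) * m * det n (minor j N)))
          (trans (sym (L≡M 0F (λ ()) j)) (L≡N 0F (λ ()) j)) ⟩
    a * laplaceTerm n M j + b * laplaceTerm n N j ∎
  where
  minors≡ : ∀ {K} → (∀ i → i ≢ F.suc r → ∀ j → L i j ≡ K i j) →
            ∀ j i → i ≢ r → ∀ c → minor j L i c ≡ minor j K i c
  minors≡ L≡K j i i≢r c = L≡K (F.suc i) (i≢r ∘ FP.suc-injective) (punchIn j c)
  distribute : ∀ s a b x d e → s * x * (a * d + b * e) ≡ a * (s * x * d) + b * (s * x * e)
  distribute = solve-∀

swap01 : ∀ {n} → Matrix (suc (suc n)) → Matrix (suc (suc n))
swap01 M 0F     = M 1F
swap01 M 1F     = M 0F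
swap01 M (2+ r) = M (2+ r)

pairSign : ∀ {n} {a b : Fin (suc n)} → a ≢ b → ℤ
pairSign {a = a} a≢b = sgn (toℕ a) * sgn (toℕ (punchOut a≢b))

pairSign-antisym : ∀ {n} {a b : Fin (suc n)} (a≢b : a ≢ b) (b≢a : b ≢ a) →
                   pairSign a≢b ≡ - pairSign b≢a
pairSign-antisym {a = 0F}      {0F}      a≢b b≢a = ⊥-elim (a≢b refl)
pairSign-antisym {zero}  {a = 0F}      {F.suc ()}
pairSign-antisym {zero}  {a = F.suc ()}
pairSign-antisym {suc n} {a = 0F}      {F.suc b} a≢b b≢a = flip-sign (sgn (toℕ b))
  where
  flip-sign : ∀ s → + 1 * s ≡ - (- s * + 1)
  flip-sign = solve-∀
pairSign-antisym {suc n} {a = F.suc a} {0F}      a≢b b≢a = flip-sign (sgn (toℕ a))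
  where
  flip-sign : ∀ s → - s * + 1 ≡ - (+ 1 * s)
  flip-sign = solve-∀
pairSign-antisym {suc n} {a = F.suc a} {F.suc b} a≢b b≢a =
  trans (neg*neg (sgn (toℕ a)) (sgn (toℕ (punchOut (a≢b ∘ cong F.suc)))))
        (trans (pairSign-antisym (a≢b ∘ cong F.suc) (b≢a ∘ cong F.suc))
               (cong -_ (sym (neg*neg (sgn (toℕ b)) (sgn (toℕ (punchOut (b≢a ∘ cong F.suc))))))))
  where
  neg*neg : ∀ x y → - x * - y ≡ x * y
  neg*neg = solve-∀

punchIn-punchOut-comm : ∀ {n} {a b : Fin (suc (suc n))} (a≢b : a ≢ b) (b≢a : b ≢ a) (c : Fin n) →
                        punchIn a (punchIn (punchOut a≢b) c) ≡ punchIn b (punchIn (punchOut b≢a) c)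
punchIn-punchOut-comm {a = 0F}      {0F}      a≢b b≢a c = ⊥-elim (a≢b refl)
punchIn-punchOut-comm {a = 0F}      {F.suc b} a≢b b≢a c = refl
punchIn-punchOut-comm {a = F.suc a} {0F}      a≢b b≢a c = refl
punchIn-punchOut-comm {suc n} {F.suc a} {F.suc b} a≢b b≢a 0F = refl
punchIn-punchOut-comm {suc n} {F.suc a} {F.suc b} a≢b b≢a (F.suc c) =
  cong F.suc (punchIn-punchOut-comm (a≢b ∘ cong F.suc) (b≢a ∘ cong F.suc) c)

-- Expanding along row 0 and then along the old row 1 writes det M as a sum over ordered pairs
-- (a, b) of distinct columns; swapping rows 0 and 1 exchanges a and b and flips the sign.
pairTerm : ∀ {n} → Matrix (suc (suc n)) → (a b : Fin (suc (suc n))) → Dec (a ≡ b) → ℤ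
pairTerm M a b (yes _)   = + 0
pairTerm M a b (no a≢b) =
  pairSign a≢b * (M 0F a * M 1F b) * det _ (minor (punchOut a≢b) (minor a M))

laplaceTerm≡Σ-pairTerm : ∀ n (M : Matrix (suc (suc n))) a →
                          laplaceTerm (suc n) M a ≡ Σℤ (suc (suc n)) (λ b → pairTerm M a b (a F.≟ b))
laplaceTerm≡Σ-pairTerm n M a = begin
    sgn (toℕ a) * M 0F a * Σℤ (suc n) (laplaceTerm n (minor a M))
  ≡⟨ sym (Σℤ-*ˡ (suc n) (sgn (toℕ a) * M 0F a) (laplaceTerm n (minor a M))) ⟩
    Σℤ (suc n) (λ k → sgn (toℕ a) * M 0F a * laplaceTerm n (minor a M) k)
  ≡⟨ Σℤ-cong (suc n) (λ k → sym (pairTerm-punchIn k (a F.≟ punchIn a k))) ⟩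
    Σℤ (suc n) (λ k → pairTerm M a (punchIn a k) (a F.≟ punchIn a k))
  ≡⟨ sym (ℤP.+-identityˡ _) ⟩
    + 0 + Σℤ (suc n) (λ k → pairTerm M a (punchIn a k) (a F.≟ punchIn a k))
  ≡⟨ cong (_+ Σℤ (suc n) (λ k → pairTerm M a (punchIn a k) (a F.≟ punchIn a k)))
          (sym (pairTerm-diagonal (a F.≟ a))) ⟩
    pairTerm M a a (a F.≟ a) + Σℤ (suc n) (λ k → pairTerm M a (punchIn a k) (a F.≟ punchIn a k))
  ≡⟨ sym (Σℤ-punchIn (suc n) a (λ b → pairTerm M a b (a F.≟ b))) ⟩
    Σℤ (suc (suc n)) (λ b → pairTerm M a b (a F.≟ b)) ∎
  where
  pairTerm-diagonal : (d : Dec (a ≡ a)) → pairTerm M a a d ≡ + 0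
  pairTerm-diagonal (yes _)  = refl
  pairTerm-diagonal (no a≢a) = ⊥-elim (a≢a refl)
  regroup : ∀ sa sk x y d → sa * sk * (x * y) * d ≡ sa * x * (sk * y * d)
  regroup = solve-∀
  pairTerm-punchIn : ∀ k (d : Dec (a ≡ punchIn a k)) →
                     pairTerm M a (punchIn a k) d ≡ sgn (toℕ a) * M 0F a * laplaceTerm n (minor a M) k
  pairTerm-punchIn k (yes a≡b) = ⊥-elim (FP.punchInᵢ≢i a k (sym a≡b))
  pairTerm-punchIn k (no a≢b) = begin
      pairTerm M a (punchIn a k) (no a≢b)
    ≡⟨ cong (λ k′ → sgn (toℕ a) * sgn (toℕ k′) * (M 0F a * M 1F (punchIn a k)) * det n (minor k′ (minor a M)))
            (trans (FP.punchOut-cong a {i≢j = a≢b} refl) (FP.punchOut-punchIn a)) ⟩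
      sgn (toℕ a) * sgn (toℕ k) * (M 0F a * M 1F (punchIn a k)) * det n (minor k (minor a M))
    ≡⟨ regroup (sgn (toℕ a)) (sgn (toℕ k)) (M 0F a) _ _ ⟩
      sgn (toℕ a) * M 0F a * laplaceTerm n (minor a M) k ∎

pairTerm-swap01 : ∀ {n} (M : Matrix (suc (suc n))) a b →
                  pairTerm (swap01 M) a b (a F.≟ b) ≡ - pairTerm M b a (b F.≟ a)
pairTerm-swap01 {n} M a b with a F.≟ b | b F.≟ a
... | yes _   | yes _   = refl
... | yes a≡b | no b≢a  = ⊥-elim (b≢a (sym a≡b))
... | no a≢b  | yes b≡a = ⊥-elim (a≢b (sym b≡a))
... | no a≢b  | no b≢a  = begin
    pairSign a≢b * (M 1F a * M 0F b) * det n (minor (punchOut a≢b) (minor a (swap01 M)))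
  ≡⟨ cong₂ (λ s d → s * (M 1F a * M 0F b) * d) (pairSign-antisym a≢b b≢a)
           (det-cong n (λ r c → cong (M (2+ r)) (punchIn-punchOut-comm a≢b b≢a c))) ⟩
    - pairSign b≢a * (M 1F a * M 0F b) * det n (minor (punchOut b≢a) (minor b M))
  ≡⟨ commute (pairSign b≢a) (M 1F a) (M 0F b) _ ⟩
    - (pairSign b≢a * (M 0F b * M 1F a) * det n (minor (punchOut b≢a) (minor b M))) ∎
  where
  commute : ∀ s x y d → - s * (x * y) * d ≡ - (s * (y * x) * d)
  commute = solve-∀

det-swap01 : ∀ n (M : Matrix (suc (suc n))) → det (suc (suc n)) (swap01 M) ≡ - det (suc (suc n)) M
det-swap01 n M = begin
    Σℤ (suc (suc n)) (laplaceTerm (suc n) (swap01 M))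
  ≡⟨ Σℤ-cong (suc (suc n)) (laplaceTerm≡Σ-pairTerm n (swap01 M)) ⟩
    Σℤ (suc (suc n)) (λ a → Σℤ (suc (suc n)) (λ b → pairTerm (swap01 M) a b (a F.≟ b)))
  ≡⟨ Σℤ-cong (suc (suc n)) (λ a → Σℤ-cong (suc (suc n)) (pairTerm-swap01 M a)) ⟩
    Σℤ (suc (suc n)) (λ a → Σℤ (suc (suc n)) (λ b → - pairTerm M b a (b F.≟ a)))
  ≡⟨ Σℤ-cong (suc (suc n)) (λ a → Σℤ-neg (suc (suc n)) (λ b → pairTerm M b a (b F.≟ a))) ⟩
    Σℤ (suc (suc n)) (λ a → - Σℤ (suc (suc n)) (λ b → pairTerm M b a (b F.≟ a)))
  ≡⟨ Σℤ-neg (suc (suc n)) (λ a → Σℤ (suc (suc n)) (λ b → pairTerm M b a (b F.≟ a))) ⟩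
    - Σℤ (suc (suc n)) (λ a → Σℤ (suc (suc n)) (λ b → pairTerm M b a (b F.≟ a)))
  ≡⟨ cong -_ (Σℤ-comm (suc (suc n)) (suc (suc n)) (λ a b → pairTerm M b a (b F.≟ a))) ⟩
    - Σℤ (suc (suc n)) (λ b → Σℤ (suc (suc n)) (λ a → pairTerm M b a (b F.≟ a)))
  ≡⟨ cong -_ (Σℤ-cong (suc (suc n)) (λ b → sym (laplaceTerm≡Σ-pairTerm n M b))) ⟩
    - det (suc (suc n)) M ∎

x≡-x⇒x≡0 : ∀ {x} → x ≡ - x → x ≡ + 0
x≡-x⇒x≡0 {+ zero}  _ = refl
x≡-x⇒x≡0 {+ suc _} ()
x≡-x⇒x≡0 { -[1+ _ ]} ()

det-minors-zero : ∀ n (M : Matrix (suc n)) → (∀ j → det n (minor j M) ≡ + 0) → det (suc n) M ≡ + 0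
det-minors-zero n M minors≡0 = Σℤ-zero (suc n) λ j →
  trans (cong (sgn (toℕ j) * M 0F j *_) (minors≡0 j)) (ℤP.*-zeroʳ (sgn (toℕ j) * M 0F j))

-- If b > 0, swapping rows 0 and 1 moves the repeated row below row 0, so that every minor
-- of the swapped matrix has two equal rows.
det-equal-row0 : ∀ n (M : Matrix (suc n)) (b : Fin n) → (∀ j → M 0F j ≡ M (F.suc b) j) → det (suc n) M ≡ + 0
det-equal-row0 (suc n) M 0F rows≡ = x≡-x⇒x≡0 (trans (det-cong (suc (suc n)) swap01≡) (det-swap01 n M))
  where
  swap01≡ : ∀ i j → M i j ≡ swap01 M i j
  swap01≡ 0F     j = rows≡ j
  swap01≡ 1F     j = sym (rows≡ j)
  swap01≡ (2+ _) j = refl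
det-equal-row0 (suc n) M (F.suc b) rows≡ = ℤP.neg-injective (begin
    - det (suc (suc n)) M
  ≡⟨ sym (det-swap01 n M) ⟩
    det (suc (suc n)) (swap01 M)
  ≡⟨ det-minors-zero (suc n) (swap01 M) (λ j → det-equal-row0 n (minor j (swap01 M)) b (rows≡ ∘ punchIn j)) ⟩
    + 0 ∎)

det-equal-rows : ∀ n (M : Matrix n) {a b : Fin n} → a ≢ b → (∀ j → M a j ≡ M b j) → det n M ≡ + 0
det-equal-rows (suc n) M {0F}      {0F}      a≢b rows≡ = ⊥-elim (a≢b refl)
det-equal-rows (suc n) M {0F}      {F.suc b} a≢b rows≡ = det-equal-row0 n M b rows≡
det-equal-rows (suc n) M {F.suc a} {0F}      a≢b rows≡ = det-equal-row0 n M a (sym ∘ rows≡)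
det-equal-rows (suc n) M {F.suc a} {F.suc b} a≢b rows≡ =
  det-minors-zero n M (λ j → det-equal-rows n (minor j M) (a≢b ∘ cong F.suc) (rows≡ ∘ punchIn j))

if-≟-same : ∀ {A : Set} {n} (i : Fin n) {x y : A} → (if does (i F.≟ i) then x else y) ≡ x
if-≟-same i with i F.≟ i
... | yes _   = refl
... | no i≢i = ⊥-elim (i≢i refl)

if-≟-distinct : ∀ {A : Set} {n} {i j : Fin n} {x y : A} → i ≢ j → (if does (i F.≟ j) then x else y) ≡ y
if-≟-distinct {i = i} {j} i≢j with i F.≟ j
... | yes i≡j = ⊥-elim (i≢j i≡j)
... | no _    = refl

replaceRow : ∀ {n} → Matrix n → Fin n → (Fin n → ℤ) → Matrix n
replaceRow M r u i = if does (i F.≟ r) then u else M i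

replaceRow-here : ∀ {n} (M : Matrix n) r u j → replaceRow M r u r j ≡ u j
replaceRow-here M r u j = cong (λ row → row j) (if-≟-same r {u} {M r})

replaceRow-there : ∀ {n} (M : Matrix n) {r i} u → i ≢ r → ∀ j → replaceRow M r u i j ≡ M i j
replaceRow-there M {i = i} u i≢r j = cong (λ row → row j) (if-≟-distinct {x = u} {M i} i≢r)

det-replaceRow-Σ : ∀ n m (M : Matrix n) r (c : Fin m → ℤ) (V : Fin m → Fin n → ℤ) →
                   det n (replaceRow M r (λ j → Σℤ m (λ k → c k * V k j)))
                     ≡ Σℤ m (λ k → c k * det n (replaceRow M r (V k)))
det-replaceRow-Σ n zero M r c V = begin
    det n (replaceRow M r (λ _ → + 0))
  ≡⟨ det-linear-row n r (+ 0) (+ 0) (λ i → replaceRow-there M _) (λ i → replaceRow-there M _)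
                     (λ j → trans (replaceRow-here M r _ j) (sym (ℤP.+-identityʳ _))) ⟩
    + 0 * det n M + + 0 * det n M
  ≡⟨⟩
    + 0 ∎
det-replaceRow-Σ n (suc m) M r c V = begin
    det n (replaceRow M r (λ j → Σℤ (suc m) (λ k → c k * V k j)))
  ≡⟨ det-linear-row n r (c 0F) (+ 1)
       (λ i i≢r j → trans (replaceRow-there M _ i≢r j) (sym (replaceRow-there M _ i≢r j)))
       (λ i i≢r j → trans (replaceRow-there M _ i≢r j) (sym (replaceRow-there M _ i≢r j)))
       (λ j → trans (replaceRow-here M r _ j)
                (cong₂ _+_ (cong (c 0F *_) (sym (replaceRow-here M r (V 0F) j)))
                           (trans (sym (ℤP.*-identityˡ _)) (cong (+ 1 *_) (sym (replaceRow-here M r rest j)))))) ⟩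
    c 0F * det n (replaceRow M r (V 0F)) + + 1 * det n (replaceRow M r rest)
  ≡⟨ cong (_+_ (c 0F * det n (replaceRow M r (V 0F))))
          (trans (ℤP.*-identityˡ _) (det-replaceRow-Σ n m M r (c ∘ F.suc) (V ∘ F.suc))) ⟩
    Σℤ (suc m) (λ k → c k * det n (replaceRow M r (V k))) ∎
  where
  rest : Fin n → ℤ
  rest j = Σℤ m (λ k → c (F.suc k) * V (F.suc k) j)

det-add-to-row : ∀ n (r : Fin n) (c : Fin n → ℤ) {L M : Matrix n} → c r ≡ + 0 →
                 (∀ i → i ≢ r → ∀ j → L i j ≡ M i j) →
                 (∀ j → L r j ≡ M r j + Σℤ n (λ k → c k * M k j)) →
                 det n L ≡ det n M
det-add-to-row n r c {L} {M} cr≡0 L≡M Lr = begin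
    det n L
  ≡⟨ det-linear-row n r (+ 1) (+ 1) {L} {M} {replaceRow M r combination} L≡M
       (λ i i≢r j → trans (L≡M i i≢r j) (sym (replaceRow-there M combination i≢r j)))
       (λ j → trans (Lr j) (cong₂ _+_ (sym (ℤP.*-identityˡ (M r j)))
                                      (sym (trans (cong (+ 1 *_) (replaceRow-here M r combination j))
                                                  (ℤP.*-identityˡ (combination j)))))) ⟩
    + 1 * det n M + + 1 * det n (replaceRow M r combination)
  ≡⟨ cong₂ _+_ (ℤP.*-identityˡ (det n M))
               (trans (ℤP.*-identityˡ _) (det-replaceRow-Σ n n M r c M)) ⟩
    det n M + Σℤ n (λ k → c k * det n (replaceRow M r (M k)))
  ≡⟨ cong (_+_ (det n M)) (Σℤ-zero n term≡0) ⟩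
    det n M + + 0
  ≡⟨ ℤP.+-identityʳ (det n M) ⟩
    det n M ∎
  where
  combination : Fin n → ℤ
  combination j = Σℤ n (λ k → c k * M k j)
  term≡0 : ∀ k → c k * det n (replaceRow M r (M k)) ≡ + 0
  term≡0 k with k F.≟ r
  ... | yes refl = trans (cong (_* det n (replaceRow M r (M k))) cr≡0) (ℤP.*-zeroˡ (det n (replaceRow M r (M k))))
  ... | no k≢r   = trans (cong (c k *_) (det-equal-rows n _ (k≢r ∘ sym) rows≡)) (ℤP.*-zeroʳ (c k))
    where
    rows≡ : ∀ j → replaceRow M r (M k) r j ≡ replaceRow M r (M k) k j
    rows≡ j = trans (replaceRow-here M r (M k) j) (sym (replaceRow-there M (M k) k≢r j))

-- The additions are performed one row at a time (`updatedBelow t` has rows 0 … t−1 updated);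
-- since no updated row is a source, each step is a single-row addition.
module SimultaneousRowAddition (n : ℕ) (M : Matrix n) (C : Fin n → Fin n → ℤ)
                               (sources-untouched : ∀ i k → C i k ≡ + 0 ⊎ (∀ j → C k j ≡ + 0)) where

  added : Fin n → Fin n → ℤ
  added i j = Σℤ n (λ k → C i k * M k j)

  updatedBelow : ℕ → Matrix n
  updatedBelow t i = if toℕ i ℕ.<ᵇ t then (λ j → M i j + added i j) else M i

  updated-below : ∀ {t i} → toℕ i ℕ.< t → ∀ j → updatedBelow t i j ≡ M i j + added i j
  updated-below {t} {i} i<t j with toℕ i ℕ.<ᵇ t | ℕP.<ᵇ-reflects-< (toℕ i) t
  ... | true  | _       = refl
  ... | false | ofⁿ i≮t = ⊥-elim (i≮t i<t)

  updated-above : ∀ {t i} → ¬ toℕ i ℕ.< t → ∀ j → updatedBelow t i j ≡ M i j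
  updated-above {t} {i} i≮t j with toℕ i ℕ.<ᵇ t | ℕP.<ᵇ-reflects-< (toℕ i) t
  ... | true  | ofʸ i<t = ⊥-elim (i≮t i<t)
  ... | false | _       = refl

  updatedBelow-suc : ∀ t {i} → toℕ i ≢ t → ∀ j → updatedBelow (suc t) i j ≡ updatedBelow t i j
  updatedBelow-suc t {i} i≢t j
    with toℕ i ℕ.<ᵇ suc t | ℕP.<ᵇ-reflects-< (toℕ i) (suc t) | toℕ i ℕ.<ᵇ t | ℕP.<ᵇ-reflects-< (toℕ i) t
  ... | true  | _           | true  | _       = refl
  ... | false | _           | false | _       = refl
  ... | true  | ofʸ i<1+t   | false | ofⁿ i≮t = ⊥-elim (i≮t (ℕP.≤∧≢⇒< (ℕP.≤-pred i<1+t) i≢t))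
  ... | false | ofⁿ i≮1+t   | true  | ofʸ i<t = ⊥-elim (i≮1+t (ℕP.m<n⇒m<1+n i<t))

  untouched-row : ∀ t {k} → (∀ j → C k j ≡ + 0) → ∀ j → updatedBelow t k j ≡ M k j
  untouched-row t {k} Ck≡0 j with toℕ k ℕ.<ᵇ t
  ... | true  = trans (cong (_+_ (M k j)) (Σℤ-zero n (λ l → trans (cong (_* M l j) (Ck≡0 l)) (ℤP.*-zeroˡ (M l j)))))
                      (ℤP.+-identityʳ (M k j))
  ... | false = refl

  source-row : ∀ t r k j → C r k * updatedBelow t k j ≡ C r k * M k j
  source-row t r k j with sources-untouched r k
  ... | inj₁ Crk≡0 = trans (cong (_* updatedBelow t k j) Crk≡0)
                     (trans (ℤP.*-zeroˡ (updatedBelow t k j))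
                            (sym (trans (cong (_* M k j) Crk≡0) (ℤP.*-zeroˡ (M k j)))))
  ... | inj₂ Ck≡0  = cong (C r k *_) (untouched-row t Ck≡0 j)

  diagonal≡0 : ∀ r → C r r ≡ + 0
  diagonal≡0 r with sources-untouched r r
  ... | inj₁ Crr≡0 = Crr≡0
  ... | inj₂ Cr≡0  = Cr≡0 r

  det-step : ∀ t → det n (updatedBelow (suc t)) ≡ det n (updatedBelow t)
  det-step t with t ℕ.<? n
  ... | no t≮n = det-cong n (λ i → updatedBelow-suc t (λ i≡t → t≮n (subst (ℕ._< n) i≡t (FP.toℕ<n i))))
  ... | yes t<n = det-add-to-row n r (C r) (diagonal≡0 r)
                    (λ i i≢r → updatedBelow-suc t (i≢r ∘ FP.toℕ-injective ∘ flip trans (sym toℕr≡t)))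
                    (λ j → begin
                        updatedBelow (suc t) r j
                      ≡⟨ updated-below (subst (ℕ._< suc t) (sym toℕr≡t) (ℕP.n<1+n t)) j ⟩
                        M r j + added r j
                      ≡⟨ cong₂ _+_ (sym (updated-above (ℕP.<-irrefl toℕr≡t) j))
                                   (Σℤ-cong n (λ k → sym (source-row t r k j))) ⟩
                        updatedBelow t r j + Σℤ n (λ k → C r k * updatedBelow t k j) ∎)
    where
    r : Fin n
    r = F.fromℕ< t<n
    toℕr≡t : toℕ r ≡ t
    toℕr≡t = FP.toℕ-fromℕ< t<n

  det-updatedBelow : ∀ t → det n (updatedBelow t) ≡ det n (updatedBelow 0)
  det-updatedBelow zero    = refl
  det-updatedBelow (suc t) = trans (det-step t) (det-updatedBelow t)

  det-add-rows : det n (λ i j → M i j + added i j) ≡ det n M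
  det-add-rows = begin
      det n (λ i j → M i j + added i j)
    ≡⟨ det-cong n (λ i j → sym (updated-below (FP.toℕ<n i) j)) ⟩
      det n (updatedBelow n)
    ≡⟨ det-updatedBelow n ⟩
      det n (updatedBelow 0)
    ≡⟨ det-cong n (λ i → updated-above {0} (λ ())) ⟩
      det n M ∎

open SimultaneousRowAddition using (det-add-rows)

Πℤ : (n : ℕ) → (Fin n → ℤ) → ℤ
Πℤ zero    f = + 1
Πℤ (suc n) f = f 0F * Πℤ n (f ∘ F.suc)

det-scale-rows : ∀ n (f : Fin n → ℤ) (M : Matrix n) →
                 det n (λ i j → f i * M i j) ≡ Πℤ n f * det n M
det-scale-rows zero    f M = refl
det-scale-rows (suc n) f M = begin
    Σℤ (suc n) (λ j → sgn (toℕ j) * (f 0F * M 0F j) * det n (λ r c → f (F.suc r) * minor j M r c))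
  ≡⟨ Σℤ-cong (suc n) (λ j → begin
       sgn (toℕ j) * (f 0F * M 0F j) * det n (λ r c → f (F.suc r) * minor j M r c)
     ≡⟨ cong (sgn (toℕ j) * (f 0F * M 0F j) *_) (det-scale-rows n (f ∘ F.suc) (minor j M)) ⟩
       sgn (toℕ j) * (f 0F * M 0F j) * (Πℤ n (f ∘ F.suc) * det n (minor j M))
     ≡⟨ regroup (sgn (toℕ j)) (f 0F) (M 0F j) _ _ ⟩
       Πℤ (suc n) f * laplaceTerm n M j ∎) ⟩
    Σℤ (suc n) (λ j → Πℤ (suc n) f * laplaceTerm n M j)
  ≡⟨ Σℤ-*ˡ (suc n) (Πℤ (suc n) f) (laplaceTerm n M) ⟩
    Πℤ (suc n) f * det (suc n) M ∎
  where
  regroup : ∀ s x m p d → s * (x * m) * (p * d) ≡ (x * p) * (s * m * d)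
  regroup = solve-∀

det-lowerTriangular : ∀ n (M : Matrix n) → (∀ i j → i F.< j → M i j ≡ + 0) →
                      det n M ≡ Πℤ n (λ i → M i i)
det-lowerTriangular zero    M upper≡0 = refl
det-lowerTriangular (suc n) M upper≡0 = begin
    + 1 * M 0F 0F * det n (minor 0F M) + Σℤ n (λ j → laplaceTerm n M (F.suc j))
  ≡⟨ cong₂ _+_ (cong (+ 1 * M 0F 0F *_) (det-lowerTriangular n (minor 0F M) (λ i j i<j → upper≡0 _ _ (ℕ.s≤s i<j))))
               (Σℤ-zero n (λ j → trans (cong (λ m → sgn (toℕ (F.suc j)) * m * det n (minor (F.suc j) M))
                                             (upper≡0 0F (F.suc j) (ℕ.s≤s ℕ.z≤n)))
                                       (vanish (sgn (toℕ (F.suc j))) (det n (minor (F.suc j) M))))) ⟩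
    + 1 * M 0F 0F * Πℤ n (λ i → M (F.suc i) (F.suc i)) + + 0
  ≡⟨ simplify (M 0F 0F) _ ⟩
    Πℤ (suc n) (λ i → M i i) ∎
  where
  vanish : ∀ s d → s * + 0 * d ≡ + 0
  vanish = solve-∀
  simplify : ∀ x p → + 1 * x * p + + 0 ≡ x * p
  simplify = solve-∀

δ : ∀ {n} → Fin n → Fin n → ℤ
δ i j = if does (i F.≟ j) then + 1 else + 0

δ-comm : ∀ {n} (i j : Fin n) → δ i j ≡ δ j i
δ-comm i j with i F.≟ j | j F.≟ i
... | yes _   | yes _   = refl
... | no  _   | no  _   = refl
... | yes i≡j | no  j≢i = ⊥-elim (j≢i (sym i≡j))
... | no  i≢j | yes j≡i = ⊥-elim (i≢j (sym j≡i))

δ-< : ∀ {n} {i j : Fin n} → i F.< j → δ i j ≡ + 0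
δ-< i<j = if-≟-distinct (λ i≡j → ℕP.<-irrefl (cong toℕ i≡j) i<j)

Σℤ-δ : ∀ {n} (c : Fin n) (g : Fin n → ℤ) → Σℤ n (λ k → δ c k * g k) ≡ g c
Σℤ-δ {suc n} c g = begin
    Σℤ (suc n) (λ k → δ c k * g k)
  ≡⟨ Σℤ-punchIn n c (λ k → δ c k * g k) ⟩
    δ c c * g c + Σℤ n (λ k → δ c (punchIn c k) * g (punchIn c k))
  ≡⟨ cong₂ _+_ (trans (cong (_* g c) (if-≟-same c)) (ℤP.*-identityˡ (g c)))
               (Σℤ-zero n (λ k → trans (cong (_* g (punchIn c k)) (if-≟-distinct (FP.punchInᵢ≢i c k ∘ sym)))
                                       (ℤP.*-zeroˡ (g (punchIn c k))))) ⟩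
    g c + + 0
  ≡⟨ ℤP.+-identityʳ (g c) ⟩
    g c ∎

Πℤ-one : ∀ n {f : Fin n → ℤ} → (∀ i → f i ≡ + 1) → Πℤ n f ≡ + 1
Πℤ-one zero    f≗1 = refl
Πℤ-one (suc n) f≗1 = cong₂ _*_ (f≗1 0F) (Πℤ-one n (f≗1 ∘ F.suc))

det-2×2-corner : ∀ n (M : Matrix (suc (suc n))) →
                (∀ j → M 0F (2+ j) ≡ + 0) → (∀ j → M 1F (2+ j) ≡ + 0) →
                (∀ i j → M (2+ i) (2+ j) ≡ δ i j) →
                det (suc (suc n)) M ≡ M 0F 0F * M 1F 1F - M 0F 1F * M 1F 0F
det-2×2-corner n M row0 row1 block = begin
    + 1 * M 0F 0F * det (suc n) (minor 0F M)
      + (- + 1 * M 0F 1F * det (suc n) (minor 1F M) + Σℤ n (λ j → laplaceTerm (suc n) M (2+ j)))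
  ≡⟨ cong₂ (λ d e → + 1 * M 0F 0F * d + (- + 1 * M 0F 1F * e + Σℤ n (λ j → laplaceTerm (suc n) M (2+ j))))
           (corner (minor 0F M) row1 block) (corner (minor 1F M) row1 block) ⟩
    + 1 * M 0F 0F * (M 1F 1F * + 1) + (- + 1 * M 0F 1F * (M 1F 0F * + 1) + Σℤ n (λ j → laplaceTerm (suc n) M (2+ j)))
  ≡⟨ cong (λ s → + 1 * M 0F 0F * (M 1F 1F * + 1) + (- + 1 * M 0F 1F * (M 1F 0F * + 1) + s))
          (Σℤ-zero n (λ j → trans (cong (λ m → sgn (toℕ (2+ j)) * m * det (suc n) (minor (2+ j) M)) (row0 j))
                                  (vanish (sgn (toℕ (2+ j))) _))) ⟩
    + 1 * M 0F 0F * (M 1F 1F * + 1) + (- + 1 * M 0F 1F * (M 1F 0F * + 1) + + 0)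
  ≡⟨ simplify (M 0F 0F) (M 1F 1F) (M 0F 1F) (M 1F 0F) ⟩
    M 0F 0F * M 1F 1F - M 0F 1F * M 1F 0F ∎
  where
  vanish : ∀ s d → s * + 0 * d ≡ + 0
  vanish = solve-∀
  simplify : ∀ w x y z → + 1 * w * (x * + 1) + (- + 1 * y * (z * + 1) + + 0) ≡ w * x - y * z
  simplify = solve-∀
  corner : (N : Matrix (suc n)) → (∀ j → N 0F (F.suc j) ≡ + 0) → (∀ i j → N (F.suc i) (F.suc j) ≡ δ i j) →
           det (suc n) N ≡ N 0F 0F * + 1
  corner N top rest = trans (det-lowerTriangular (suc n) N upper≡0)
                            (cong (N 0F 0F *_) (Πℤ-one n (λ i → trans (rest i i) (if-≟-same i))))
    where
    upper≡0 : ∀ i j → i F.< j → N i j ≡ + 0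
    upper≡0 0F        (F.suc j) _         = top j
    upper≡0 (F.suc i) (F.suc j) (ℕ.s≤s i<j) = trans (rest i j) (δ-< i<j)

count : ∀ {n} → (Fin n → Bool) → ℕ
count {zero}  v = 0
count {suc n} v = (if v 0F then 1 else 0) ℕ.+ count (v ∘ F.suc)

Σℤ-indicator : ∀ n (v : Fin n → Bool) → Σℤ n (λ i → if v i then + 1 else + 0) ≡ + count v
Σℤ-indicator zero    v = refl
Σℤ-indicator (suc n) v with v 0F
... | true  = cong (_+_ (+ 1)) (Σℤ-indicator n (v ∘ F.suc))
... | false = trans (ℤP.+-identityˡ _) (Σℤ-indicator n (v ∘ F.suc))

Πℤ-select : ∀ n (v : Fin n → Bool) (a b : ℤ) →
            Πℤ n (λ i → if v i then b else a) ≡ a ℤ.^ count (not ∘ v) * b ℤ.^ count v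
Πℤ-select zero    v a b = refl
Πℤ-select (suc n) v a b with v 0F
... | true  = trans (cong (b *_) (Πℤ-select n (v ∘ F.suc) a b))
                  (x*[y*z]≡y*[x*z] b (a ℤ.^ count (not ∘ v ∘ F.suc)) (b ℤ.^ count (v ∘ F.suc)))
... | false = trans (cong (a *_) (Πℤ-select n (v ∘ F.suc) a b))
                  (sym (ℤP.*-assoc a (a ℤ.^ count (not ∘ v ∘ F.suc)) (b ℤ.^ count (v ∘ F.suc))))

count-not+count : ∀ n (v : Fin n → Bool) → count (not ∘ v) ℕ.+ count v ≡ n
count-not+count zero    v = refl
count-not+count (suc n) v with v 0F
... | true  = trans (ℕP.+-suc _ _) (cong suc (count-not+count n (v ∘ F.suc)))
... | false = cong suc (count-not+count n (v ∘ F.suc))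

count-cong : ∀ {n} {u v : Fin n → Bool} → (∀ i → u i ≡ v i) → count u ≡ count v
count-cong {zero}  u≗v = refl
count-cong {suc n} u≗v = cong₂ (λ c r → (if c then 1 else 0) ℕ.+ r) (u≗v 0F) (count-cong (u≗v ∘ F.suc))

length-filter-applyUpTo : ∀ {P : ℕ → Set} (P? : Decidable P) n (f : ℕ → ℕ) →
                          length (filter P? (applyUpTo f n)) ≡ count (λ (i : Fin n) → does (P? (f (toℕ i))))
length-filter-applyUpTo P? zero    f = refl
length-filter-applyUpTo P? (suc n) f with does (P? (f 0))
... | true  = cong suc (length-filter-applyUpTo P? n (f ∘ suc))
... | false = length-filter-applyUpTo P? n (f ∘ suc)

-- With a = x − n and b = x − #{i | not (w i)} this is xI − L for the graph on Fin n in which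
-- i and j are adjacent iff not both w i and w j hold.
twoClassMatrix : ∀ {n} → (Fin n → Bool) → ℤ → ℤ → Matrix n
twoClassMatrix w a b i j = (if w i then b else a) * δ i j + (if w i ∧ w j then + 0 else + 1)

twoClass-offDiagonal : ∀ {n} (w : Fin n → Bool) a b {i j} → i ≢ j →
                       twoClassMatrix w a b i j ≡ (if w i ∧ w j then + 0 else + 1)
twoClass-offDiagonal w a b {i} {j} i≢j =
  trans (cong (λ e → (if w i then b else a) * e + (if w i ∧ w j then + 0 else + 1)) (if-≟-distinct i≢j))
        (trans (cong (_+ (if w i ∧ w j then + 0 else + 1)) (ℤP.*-zeroʳ (if w i then b else a)))
               (ℤP.+-identityˡ _))

twoClass-row-difference : ∀ {n} (w : Fin n → Bool) a b {i k} → w i ≡ w k → ∀ j →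
                          twoClassMatrix w a b i j - twoClassMatrix w a b k j
                            ≡ (if w i then b else a) * (δ i j - δ k j)
twoClass-row-difference w a b {i} {k} wi≡wk j = begin
    twoClassMatrix w a b i j - twoClassMatrix w a b k j
  ≡⟨ cong (λ x → ((if x then b else a) * δ i j + (if x ∧ w j then + 0 else + 1)) - twoClassMatrix w a b k j) wi≡wk ⟩
    (d * δ i j + o) - (d * δ k j + o)
  ≡⟨ cancel d (δ i j) (δ k j) o ⟩
    d * (δ i j - δ k j)
  ≡⟨ cong (λ x → (if x then b else a) * (δ i j - δ k j)) (sym wi≡wk) ⟩
    (if w i then b else a) * (δ i j - δ k j) ∎
  where
  d o : ℤ
  d = if w k then b else a
  o = if w k ∧ w j then + 0 else + 1
  cancel : ∀ d x y o → (d * x + o) - (d * y + o) ≡ d * (x - y)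
  cancel = solve-∀

Σℤ-offDiagonal : ∀ n (i : Fin (suc n)) → Σℤ (suc n) (λ j → if does (i F.≟ j) then + 0 else + 1) ≡ + n
Σℤ-offDiagonal n i = begin
    Σℤ (suc n) (λ j → if does (i F.≟ j) then + 0 else + 1)
  ≡⟨ Σℤ-punchIn n i (λ j → if does (i F.≟ j) then + 0 else + 1) ⟩
    (if does (i F.≟ i) then + 0 else + 1) + Σℤ n (λ k → if does (i F.≟ punchIn i k) then + 0 else + 1)
  ≡⟨ cong₂ _+_ (if-≟-same i) (Σℤ-cong n (λ k → if-≟-distinct (FP.punchInᵢ≢i i k ∘ sym))) ⟩
    + 0 + Σℤ n (λ _ → + 1)
  ≡⟨ trans (ℤP.+-identityˡ _) (Σℤ-ones n) ⟩
    + n ∎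
  where
  Σℤ-ones : ∀ n → Σℤ n (λ _ → + 1) ≡ + n
  Σℤ-ones zero    = refl
  Σℤ-ones (suc n) = cong (_+_ (+ 1)) (Σℤ-ones n)

Σℤ-twoClassAdjacency : ∀ n (w : Fin (suc n) → Bool) i →
                       Σℤ (suc n) (λ j → if does (i F.≟ j) then + 0 else (if w i ∧ w j then + 0 else + 1))
                         ≡ (if w i then + count (not ∘ w) else + n)
Σℤ-twoClassAdjacency n w i with w i in wi≡
... | false = Σℤ-offDiagonal n i
... | true  = trans (Σℤ-cong (suc n) term) (Σℤ-indicator (suc n) (not ∘ w))
  where
  term : ∀ j → (if does (i F.≟ j) then + 0 else (if w j then + 0 else + 1)) ≡ (if not (w j) then + 1 else + 0)
  term j with i F.≟ j
  ... | yes refl rewrite wi≡ = refl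
  ... | no  _    with w j
  ...   | true  = refl
  ...   | false = refl

module TwoClassDeterminant (n : ℕ) (v : Fin n → Bool) (a b : ℤ) where

  w : Fin (suc (suc n)) → Bool
  w = true ∷ false ∷ v

  K : Matrix (suc (suc n))
  K = twoClassMatrix w a b

  classOf : Bool → Fin (suc (suc n))
  classOf true  = 0F
  classOf false = 1F

  w-classOf : ∀ x → w (classOf x) ≡ x
  w-classOf true  = refl
  w-classOf false = refl

  δ-classOf-2+ : ∀ x k → δ (classOf x) (2+ k) ≡ + 0
  δ-classOf-2+ true  k = refl
  δ-classOf-2+ false k = refl

  E : Fin n → Fin (suc (suc n)) → ℤ
  E i j = δ (2+ i) j - δ (classOf (v i)) j

  reduction : Fin (suc (suc n)) → Fin (suc (suc n)) → ℤ
  reduction 0F     k = + 0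
  reduction 1F     k = + 0
  reduction (2+ i) k = - δ (classOf (v i)) k

  scale : Fin (suc (suc n)) → ℤ
  scale 0F     = + 1
  scale 1F     = + 1
  scale (2+ i) = if v i then b else a

  reduced : Matrix (suc (suc n))
  reduced 0F     = K 0F
  reduced 1F     = K 1F
  reduced (2+ i) = E i

  x+Σ0*≡x : ∀ x m (g : Fin m → ℤ) → x + Σℤ m (λ k → + 0 * g k) ≡ x
  x+Σ0*≡x x m g = trans (cong (_+_ x) (Σℤ-zero m (λ k → ℤP.*-zeroˡ (g k)))) (ℤP.+-identityʳ x)

  reduce : ∀ i j → K i j + Σℤ (suc (suc n)) (λ k → reduction i k * K k j) ≡ scale i * reduced i j
  reduce 0F j = trans (x+Σ0*≡x (K 0F j) _ (λ k → K k j)) (sym (ℤP.*-identityˡ (K 0F j)))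
  reduce 1F j = trans (x+Σ0*≡x (K 1F j) _ (λ k → K k j)) (sym (ℤP.*-identityˡ (K 1F j)))
  reduce (2+ i) j = begin
      K (2+ i) j + Σℤ (suc (suc n)) (λ k → - δ (classOf (v i)) k * K k j)
    ≡⟨ cong (_+_ (K (2+ i) j)) (begin
         Σℤ (suc (suc n)) (λ k → - δ (classOf (v i)) k * K k j)
       ≡⟨ Σℤ-cong (suc (suc n)) (λ k → sym (ℤP.neg-distribˡ-* (δ (classOf (v i)) k) (K k j))) ⟩
         Σℤ (suc (suc n)) (λ k → - (δ (classOf (v i)) k * K k j))
       ≡⟨ Σℤ-neg (suc (suc n)) (λ k → δ (classOf (v i)) k * K k j) ⟩
         - Σℤ (suc (suc n)) (λ k → δ (classOf (v i)) k * K k j)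
       ≡⟨ cong -_ (Σℤ-δ (classOf (v i)) (λ k → K k j)) ⟩
         - K (classOf (v i)) j ∎) ⟩
      K (2+ i) j - K (classOf (v i)) j
    ≡⟨ twoClass-row-difference w a b {2+ i} {classOf (v i)} (sym (w-classOf (v i))) j ⟩
      (if v i then b else a) * E i j ∎

  reduction-sources : ∀ i k → reduction i k ≡ + 0 ⊎ (∀ j → reduction k j ≡ + 0)
  reduction-sources 0F     k      = inj₁ refl
  reduction-sources 1F     k      = inj₁ refl
  reduction-sources (2+ i) 0F     = inj₂ (λ _ → refl)
  reduction-sources (2+ i) 1F     = inj₂ (λ _ → refl)
  reduction-sources (2+ i) (2+ k) = inj₁ (cong -_ (δ-classOf-2+ (v i) k))

  clearing : Fin (suc (suc n)) → Fin (suc (suc n)) → ℤ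
  clearing (2+ _) _      = + 0
  clearing _      0F     = + 0
  clearing _      1F     = + 0
  clearing r      (2+ k) = - K r (2+ k)

  clearing-sources : ∀ i k → clearing i k ≡ + 0 ⊎ (∀ j → clearing k j ≡ + 0)
  clearing-sources (2+ _) _      = inj₁ refl
  clearing-sources 0F     0F     = inj₁ refl
  clearing-sources 0F     1F     = inj₁ refl
  clearing-sources 1F     0F     = inj₁ refl
  clearing-sources 1F     1F     = inj₁ refl
  clearing-sources 0F     (2+ _) = inj₂ (λ _ → refl)
  clearing-sources 1F     (2+ _) = inj₂ (λ _ → refl)

  clearedRow : (Fin (suc (suc n)) → ℤ) → Fin (suc (suc n)) → ℤ
  clearedRow u 0F     = u 0F + Σℤ n (λ k → u (2+ k) * δ (classOf (v k)) 0F)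
  clearedRow u 1F     = u 1F + Σℤ n (λ k → u (2+ k) * δ (classOf (v k)) 1F)
  clearedRow u (2+ j) = + 0

  cleared : Matrix (suc (suc n))
  cleared 0F     = clearedRow (K 0F)
  cleared 1F     = clearedRow (K 1F)
  cleared (2+ i) = E i

  clear-row : ∀ (u : Fin (suc (suc n)) → ℤ) j →
              u j + Σℤ n (λ k → - u (2+ k) * E k j) ≡ clearedRow u j
  clear-row u j = begin
      u j + Σℤ n (λ k → - u (2+ k) * E k j)
    ≡⟨ cong (_+_ (u j)) (begin
         Σℤ n (λ k → - u (2+ k) * E k j)
       ≡⟨ Σℤ-cong n (λ k → split (u (2+ k)) (δ (2+ k) j) (δ (classOf (v k)) j)) ⟩
         Σℤ n (λ k → u (2+ k) * δ (classOf (v k)) j + - (u (2+ k) * δ (2+ k) j))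
       ≡⟨ Σℤ-+ n (λ k → u (2+ k) * δ (classOf (v k)) j) (λ k → - (u (2+ k) * δ (2+ k) j)) ⟩
         toClasses j + Σℤ n (λ k → - (u (2+ k) * δ (2+ k) j))
       ≡⟨ cong (_+_ (toClasses j)) (Σℤ-neg n (λ k → u (2+ k) * δ (2+ k) j)) ⟩
         toClasses j - toGeneric j ∎) ⟩
      u j + (toClasses j - toGeneric j)
    ≡⟨ finish j ⟩
      clearedRow u j ∎
    where
    toClasses toGeneric : Fin (suc (suc n)) → ℤ
    toClasses j = Σℤ n (λ k → u (2+ k) * δ (classOf (v k)) j)
    toGeneric j = Σℤ n (λ k → u (2+ k) * δ (2+ k) j)
    split : ∀ y p q → - y * (p - q) ≡ y * q + - (y * p)
    split = solve-∀
    cancel : ∀ x → x + (+ 0 - x) ≡ + 0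
    cancel = solve-∀
    toGeneric-class : ∀ c → toGeneric (classOf c) ≡ + 0
    toGeneric-class true  = Σℤ-zero n (λ k → ℤP.*-zeroʳ (u (2+ k)))
    toGeneric-class false = Σℤ-zero n (λ k → ℤP.*-zeroʳ (u (2+ k)))
    finish : ∀ j → u j + (toClasses j - toGeneric j) ≡ clearedRow u j
    finish 0F = trans (cong (λ g → u 0F + (toClasses 0F - g)) (toGeneric-class true))
                      (cong (_+_ (u 0F)) (ℤP.+-identityʳ (toClasses 0F)))
    finish 1F = trans (cong (λ g → u 1F + (toClasses 1F - g)) (toGeneric-class false))
                      (cong (_+_ (u 1F)) (ℤP.+-identityʳ (toClasses 1F)))
    finish (2+ j) = begin
        u (2+ j) + (toClasses (2+ j) - toGeneric (2+ j))
      ≡⟨ cong₂ (λ c g → u (2+ j) + (c - g))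
               (Σℤ-zero n (λ k → trans (cong (u (2+ k) *_) (δ-classOf-2+ (v k) j)) (ℤP.*-zeroʳ (u (2+ k)))))
               (trans (Σℤ-cong n (λ k → trans (cong (u (2+ k) *_) (δ-comm k j)) (ℤP.*-comm (u (2+ k)) (δ j k))))
                      (Σℤ-δ j (λ k → u (2+ k)))) ⟩
        u (2+ j) + (+ 0 - u (2+ j))
      ≡⟨ cancel (u (2+ j)) ⟩
        + 0 ∎

  drop-zeros : ∀ x p q s → x + (+ 0 * p + (+ 0 * q + s)) ≡ x + s
  drop-zeros = solve-∀

  clear : ∀ i j → reduced i j + Σℤ (suc (suc n)) (λ k → clearing i k * reduced k j) ≡ cleared i j
  clear 0F     j = trans (drop-zeros (K 0F j) (K 0F j) (K 1F j) _) (clear-row (K 0F) j)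
  clear 1F     j = trans (drop-zeros (K 1F j) (K 0F j) (K 1F j) _) (clear-row (K 1F) j)
  clear (2+ i) j = x+Σ0*≡x (E i j) _ (λ k → reduced k j)

  classOf≢2+ : ∀ y k → classOf y ≢ 2+ k
  classOf≢2+ true  k ()
  classOf≢2+ false k ()

  Σℤ-classRow : ∀ y c (f : Bool → ℤ) → (∀ x → (if y ∧ x then + 0 else + 1) * δ (classOf x) c ≡ f x) →
               Σℤ n (λ k → K (classOf y) (2+ k) * δ (classOf (v k)) c) ≡ Σℤ n (λ k → f (v k))
  Σℤ-classRow y c f summand = Σℤ-cong n λ k → begin
      K (classOf y) (2+ k) * δ (classOf (v k)) c
    ≡⟨ cong (_* δ (classOf (v k)) c)
            (trans (twoClass-offDiagonal w a b (classOf≢2+ y k))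
                   (cong (λ z → if z ∧ v k then + 0 else + 1) (w-classOf y))) ⟩
      (if y ∧ v k then + 0 else + 1) * δ (classOf (v k)) c
    ≡⟨ summand (v k) ⟩
      f (v k) ∎

  s t : ℕ
  s = count (not ∘ v)
  t = count v

  det-cleared : det (suc (suc n)) cleared ≡ b * (a + + suc s) - + suc s * + suc t
  det-cleared = begin
      det (suc (suc n)) cleared
    ≡⟨ det-2×2-corner n cleared (λ _ → refl) (λ _ → refl)
         (λ i j → trans (cong (_-_ (δ i j)) (δ-classOf-2+ (v i) j)) (ℤP.+-identityʳ (δ i j))) ⟩
      cleared 0F 0F * cleared 1F 1F - cleared 0F 1F * cleared 1F 0F
    ≡⟨ cong₂ (λ p q → p - q) (cong₂ _*_ (cong (_+_ (K 0F 0F)) e00) (cong (_+_ (K 1F 1F)) e11))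
                             (cong₂ _*_ (cong (_+_ (K 0F 1F)) e01) (cong (_+_ (K 1F 0F)) e10)) ⟩
      (b * + 1 + + 0 + + 0) * (a * + 1 + + 1 + + s) - (b * + 0 + + 1 + + s) * (a * + 0 + + 1 + + t)
    ≡⟨ simplify a b (+ s) (+ t) ⟩
      b * (a + + suc s) - + suc s * + suc t ∎
    where
    simplify : ∀ a b s t → (b * + 1 + + 0 + + 0) * (a * + 1 + + 1 + s) - (b * + 0 + + 1 + s) * (a * + 0 + + 1 + t)
                           ≡ b * (a + (+ 1 + s)) - (+ 1 + s) * (+ 1 + t)
    simplify = solve-∀
    e00 : Σℤ n (λ k → K 0F (2+ k) * δ (classOf (v k)) 0F) ≡ + 0
    e00 = trans (Σℤ-classRow true 0F (λ _ → + 0) (λ { true → refl ; false → refl })) (Σℤ-zero n (λ _ → refl))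
    e01 : Σℤ n (λ k → K 0F (2+ k) * δ (classOf (v k)) 1F) ≡ + s
    e01 = trans (Σℤ-classRow true 1F (λ x → if not x then + 1 else + 0) (λ { true → refl ; false → refl }))
                (Σℤ-indicator n (not ∘ v))
    e10 : Σℤ n (λ k → K 1F (2+ k) * δ (classOf (v k)) 0F) ≡ + t
    e10 = trans (Σℤ-classRow false 0F (λ x → if x then + 1 else + 0) (λ { true → refl ; false → refl }))
                (Σℤ-indicator n v)
    e11 : Σℤ n (λ k → K 1F (2+ k) * δ (classOf (v k)) 1F) ≡ + s
    e11 = trans (Σℤ-classRow false 1F (λ x → if not x then + 1 else + 0) (λ { true → refl ; false → refl }))
                (Σℤ-indicator n (not ∘ v))

  det-twoClass : det (suc (suc n)) K ≡ a ℤ.^ s * b ℤ.^ t * (b * (a + + suc s) - + suc s * + suc t)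
  det-twoClass = begin
      det (suc (suc n)) K
    ≡⟨ sym (det-add-rows (suc (suc n)) K reduction reduction-sources) ⟩
      det (suc (suc n)) (λ i j → K i j + Σℤ (suc (suc n)) (λ k → reduction i k * K k j))
    ≡⟨ det-cong (suc (suc n)) reduce ⟩
      det (suc (suc n)) (λ i j → scale i * reduced i j)
    ≡⟨ det-scale-rows (suc (suc n)) scale reduced ⟩
      Πℤ (suc (suc n)) scale * det (suc (suc n)) reduced
    ≡⟨ cong₂ _*_ Πℤ-scale (sym (det-add-rows (suc (suc n)) reduced clearing clearing-sources)) ⟩
      a ℤ.^ s * b ℤ.^ t
        * det (suc (suc n)) (λ i j → reduced i j + Σℤ (suc (suc n)) (λ k → clearing i k * reduced k j))
    ≡⟨ cong (a ℤ.^ s * b ℤ.^ t *_) (trans (det-cong (suc (suc n)) clear) det-cleared) ⟩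
      a ℤ.^ s * b ℤ.^ t * (b * (a + + suc s) - + suc s * + suc t) ∎
    where
    Πℤ-scale : Πℤ (suc (suc n)) scale ≡ a ℤ.^ s * b ℤ.^ t
    Πℤ-scale = trans (ℤP.*-identityˡ _) (trans (ℤP.*-identityˡ _) (Πℤ-select n v a b))

det-twoClass-spectrum : ∀ n (v : Fin n → Bool) (x : ℤ) →
  det (suc (suc n)) (twoClassMatrix (true ∷ false ∷ v) (x - + suc (suc n)) (x - + suc (count (not ∘ v))))
    ≡ (x - + suc (suc n)) ℤ.^ suc (count (not ∘ v)) * (x - + suc (count (not ∘ v))) ℤ.^ count v * x
det-twoClass-spectrum n v x = begin
    det (suc (suc n)) (twoClassMatrix (true ∷ false ∷ v) (x - + suc (suc n)) (x - S))
  ≡⟨ cong (λ z → det (suc (suc n)) (twoClassMatrix (true ∷ false ∷ v) (x - z) (x - S))) N≡S+T ⟩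
    det (suc (suc n)) (twoClassMatrix (true ∷ false ∷ v) (x - (S + T)) (x - S))
  ≡⟨ TwoClassDeterminant.det-twoClass n v (x - (S + T)) (x - S) ⟩
    (x - (S + T)) ℤ.^ s * (x - S) ℤ.^ t * ((x - S) * ((x - (S + T)) + S) - S * T)
  ≡⟨ factor x S T ((x - (S + T)) ℤ.^ s) ((x - S) ℤ.^ t) ⟩
    (x - (S + T)) ℤ.^ suc s * (x - S) ℤ.^ t * x
  ≡⟨ cong (λ z → (x - z) ℤ.^ suc s * (x - S) ℤ.^ t * x) (sym N≡S+T) ⟩
    (x - + suc (suc n)) ℤ.^ suc s * (x - S) ℤ.^ t * x ∎
  where
  s t : ℕ
  s = count (not ∘ v)
  t = count v
  S T : ℤ
  S = + suc s
  T = + suc t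
  N≡S+T : + suc (suc n) ≡ S + T
  N≡S+T = cong (λ z → + suc z) (trans (cong suc (sym (count-not+count n v))) (sym (ℕP.+-suc s t)))
  factor : ∀ x S T A B → A * B * ((x - S) * ((x - (S + T)) + S) - S * T) ≡ (x - (S + T)) * A * B * x
  factor = solve-∀

¬∣⇒coprime-^ : ∀ {p y} → Prime p → ¬ p ∣ y → ∀ e → Coprime y (p ℕ.^ e)
¬∣⇒coprime-^ p-prime p∤y zero    (_ , d∣1) = ∣1⇒≡1 d∣1
¬∣⇒coprime-^ {p} p-prime p∤y (suc e) {d} (d∣y , d∣p^1+e) =
  ¬∣⇒coprime-^ p-prime p∤y e (d∣y , coprime-divisor d⊥p d∣p^1+e)
  where
  d⊥p : Coprime d p
  d⊥p (c∣d , c∣p) with prime⇒irreducible p-prime c∣p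
  ... | inj₁ c≡1 = c≡1
  ... | inj₂ c≡p = ⊥-elim (p∤y (∣-trans (subst (_∣ d) c≡p c∣d) d∣y))

n∣n^e : ∀ {n e} → 0 ℕ.< e → n ∣ n ℕ.^ e
n∣n^e {n} {suc e} _ = m∣m*n (n ℕ.^ e)

module PrimePowerModulus {p m n : ℕ} (p-prime : Prime p) (0<m : 0 ℕ.< m) (N≡p^m : suc (suc n) ≡ p ℕ.^ m) where

  k N : ℕ
  k = suc n
  N = suc k

  p∤1 : ¬ p ∣ 1
  p∤1 p∣1 = nonTrivial⇒≢1 {{prime⇒nonTrivial p-prime}} (∣1⇒≡1 p∣1)

  p∣N : p ∣ N
  p∣N = subst (p ∣_) (sym N≡p^m) (n∣n^e 0<m)

  ¬∣⇒coprime-N : ∀ {y} → ¬ p ∣ y → Coprime y N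
  ¬∣⇒coprime-N p∤y = subst (Coprime _) (sym N≡p^m) (¬∣⇒coprime-^ p-prime p∤y m)

  does-gcd≡1 : ∀ y → does (gcd y N ℕ.≟ 1) ≡ not (does (p ∣? y))
  does-gcd≡1 y with p ∣? y
  ... | yes p∣y = dec-false (gcd y N ℕ.≟ 1) λ gcd≡1 → p∤1 (subst (p ∣_) gcd≡1 (gcd-greatest p∣y p∣N))
  ... | no  p∤y = dec-true (gcd y N ℕ.≟ 1) (coprime⇒gcd≡1 (¬∣⇒coprime-N p∤y))

  comaximal⇒¬both-divisible : ∀ {x y} → Comaximal k x y → p ∣ toℕ x → p ∣ toℕ y → ⊥
  comaximal⇒¬both-divisible (a , b , combination≡1) p∣x p∣y =
    p∤1 (∣n∣m%n⇒∣m p∣N (subst (p ∣_) combination≡1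
      (%-presˡ-∣ (∣m∣n⇒∣m+n (∣n⇒∣m*n (toℕ a) p∣x) (∣n⇒∣m*n (toℕ b) p∣y)) p∣N)))

  -- Bézout gives a·y ≡ 1 or a·y ≡ −1 (mod N); in the second case k·a = (N − 1)·a inverts y.
  inverse : ∀ {y} → ¬ p ∣ y → Σ ℕ λ a → (a ℕ.* y) % N ≡ 1 % N
  inverse {y} p∤y with coprime-Bézout (¬∣⇒coprime-N p∤y)
  ... | Bézout.+- a c 1+cN≡ay = a , trans (cong (_% N) (sym 1+cN≡ay)) ([m+kn]%n≡m%n 1 c N)
  ... | Bézout.-+ a c 1+ay≡cN = k ℕ.* a , (begin
      (k ℕ.* a ℕ.* y) % N            ≡⟨ sym ([m+n]%n≡m%n (k ℕ.* a ℕ.* y) N) ⟩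
      (k ℕ.* a ℕ.* y ℕ.+ N) % N      ≡⟨ cong (_% N) (trans (regroup k a y) (cong (λ z → suc (k ℕ.* z)) 1+ay≡cN)) ⟩
      suc (k ℕ.* (c ℕ.* N)) % N      ≡⟨ cong (λ z → suc z % N) (sym (ℕP.*-assoc k c N)) ⟩
      (1 ℕ.+ k ℕ.* c ℕ.* N) % N      ≡⟨ [m+kn]%n≡m%n 1 (k ℕ.* c) N ⟩
      1 % N ∎)
    where
    regroup : ∀ k a y → k ℕ.* a ℕ.* y ℕ.+ suc k ≡ suc (k ℕ.* (1 ℕ.+ a ℕ.* y))
    regroup = ℕSolver.solve-∀

  unit⇒comaximal : ∀ {x} → ¬ p ∣ toℕ x → ∀ y → Comaximal k x y × Comaximal k y x
  unit⇒comaximal {x} p∤x y with inverse p∤x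
  ... | a , ax≡1 = (a′ , 0F , trans (cong (_% N) (ℕP.+-identityʳ (toℕ a′ ℕ.* toℕ x))) a′x≡1)
                 , (0F , a′ , a′x≡1)
    where
    a′ : Fin N
    a′ = F.fromℕ< (m%n<n a N)
    a′x≡1 : (toℕ a′ ℕ.* toℕ x) % N ≡ 1 % N
    a′x≡1 = begin
      (toℕ a′ ℕ.* toℕ x) % N               ≡⟨ cong (λ z → (z ℕ.* toℕ x) % N) (FP.toℕ-fromℕ< (m%n<n a N)) ⟩
      (a % N ℕ.* toℕ x) % N                ≡⟨ %-distribˡ-* (a % N) (toℕ x) N ⟩
      (a % N % N ℕ.* (toℕ x % N)) % N      ≡⟨ cong (λ z → (z ℕ.* (toℕ x % N)) % N) (m%n%n≡m%n a N) ⟩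
      (a % N ℕ.* (toℕ x % N)) % N          ≡⟨ sym (%-distribˡ-* a (toℕ x) N) ⟩
      (a ℕ.* toℕ x) % N                    ≡⟨ ax≡1 ⟩
      1 % N ∎

  nonunit : Fin N → Bool
  nonunit i = does (p ∣? toℕ i)

  does-comaximal : ∀ i j (c? : Dec (Comaximal k i j)) → does c? ≡ not (does (p ∣? toℕ i) ∧ does (p ∣? toℕ j))
  does-comaximal i j c? with p ∣? toℕ i | p ∣? toℕ j
  ... | yes p∣i | yes p∣j = dec-false c? (λ c → comaximal⇒¬both-divisible c p∣i p∣j)
  ... | yes _   | no  p∤j = dec-true c? (proj₂ (unit⇒comaximal p∤j i))
  ... | no  p∤i | _       = dec-true c? (proj₁ (unit⇒comaximal p∤i j))

  -- The decision procedure inside `adj?`, so that `adjMatrix` unfolds to its `does`.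
  comaximal? : ∀ i j → Dec (Comaximal k i j)
  comaximal? i j = FP.any? λ a → FP.any? λ b → (toℕ a ℕ.* toℕ i ℕ.+ toℕ b ℕ.* toℕ j) % N ℕ.≟ 1 % N

  adjMatrix-ℤN : ∀ i j →
    adjMatrix k i j ≡ (if does (i F.≟ j) then + 0 else (if nonunit i ∧ nonunit j then + 0 else + 1))
  adjMatrix-ℤN i j with i F.≟ j
  ... | yes _ = refl
  ... | no  _ = trans (cong (λ c → if c then + 1 else + 0) (does-comaximal i j (comaximal? i j)))
                      (if-not (nonunit i ∧ nonunit j))
    where
    if-not : ∀ c → (if not c then + 1 else + 0) ≡ (if c then + 0 else + 1)
    if-not true  = refl
    if-not false = refl

  degree-ℤN : ∀ i → degree k i ≡ (if nonunit i then + count (not ∘ nonunit) else + k)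
  degree-ℤN i = trans (Σℤ-cong N (adjMatrix-ℤN i)) (Σℤ-twoClassAdjacency k nonunit i)

  characteristicMatrix-ℤN : ∀ x i j →
    (if does (i F.≟ j) then x else + 0) - ((if does (i F.≟ j) then degree k i else + 0) - adjMatrix k i j)
      ≡ twoClassMatrix nonunit (x - + N) (x - + count (not ∘ nonunit)) i j
  characteristicMatrix-ℤN x i j = entry i j (i F.≟ j)
    where
    a b : ℤ
    a = x - + N
    b = x - + count (not ∘ nonunit)
    neg-neg : ∀ e → + 0 - (+ 0 - e) ≡ e
    neg-neg = solve-∀
    unitDiagonal : ∀ x u → x - (u - + 0) ≡ (x - u) * + 1 + + 0
    unitDiagonal = solve-∀
    nonunitDiagonal : ∀ x u → x - (u - + 0) ≡ (x - (+ 1 + u)) * + 1 + + 1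
    nonunitDiagonal = solve-∀
    diagonal : ∀ c → x - ((if c then + count (not ∘ nonunit) else + k) - + 0)
                       ≡ (if c then b else a) * + 1 + (if c ∧ c then + 0 else + 1)
    diagonal true  = unitDiagonal x (+ count (not ∘ nonunit))
    diagonal false = nonunitDiagonal x (+ k)
    entry : ∀ i j → Dec (i ≡ j) →
      (if does (i F.≟ j) then x else + 0) - ((if does (i F.≟ j) then degree k i else + 0) - adjMatrix k i j)
        ≡ twoClassMatrix nonunit a b i j
    entry i j (no i≢j) = begin
        (if does (i F.≟ j) then x else + 0) - ((if does (i F.≟ j) then degree k i else + 0) - adjMatrix k i j)
      ≡⟨ cong₂ (λ u v → u - (v - adjMatrix k i j)) (if-≟-distinct i≢j) (if-≟-distinct i≢j) ⟩
        + 0 - (+ 0 - adjMatrix k i j)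
      ≡⟨ cong (λ e → + 0 - (+ 0 - e)) (trans (adjMatrix-ℤN i j) (if-≟-distinct i≢j)) ⟩
        + 0 - (+ 0 - (if nonunit i ∧ nonunit j then + 0 else + 1))
      ≡⟨ neg-neg _ ⟩
        (if nonunit i ∧ nonunit j then + 0 else + 1)
      ≡⟨ sym (twoClass-offDiagonal nonunit a b i≢j) ⟩
        twoClassMatrix nonunit a b i j ∎
    entry i .i (yes refl) = begin
        (if does (i F.≟ i) then x else + 0) - ((if does (i F.≟ i) then degree k i else + 0) - adjMatrix k i i)
      ≡⟨ cong₂ (λ u v → u - (v - adjMatrix k i i)) (if-≟-same i) (if-≟-same i) ⟩
        x - (degree k i - adjMatrix k i i)
      ≡⟨ cong₂ (λ d e → x - (d - e)) (degree-ℤN i) (trans (adjMatrix-ℤN i i) (if-≟-same i)) ⟩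
        x - ((if nonunit i then + count (not ∘ nonunit) else + k) - + 0)
      ≡⟨ diagonal (nonunit i) ⟩
        (if nonunit i then b else a) * + 1 + (if nonunit i ∧ nonunit i then + 0 else + 1)
      ≡⟨ cong (λ e → (if nonunit i then b else a) * e + (if nonunit i ∧ nonunit i then + 0 else + 1))
              (sym (if-≟-same i)) ⟩
        twoClassMatrix nonunit a b i i ∎

  nonunit′ : Fin n → Bool
  nonunit′ i = nonunit (2+ i)

  nonunit-classes : ∀ i → nonunit i ≡ (true ∷ false ∷ nonunit′) i
  nonunit-classes 0F     = dec-true (p ∣? 0) (p ∣0)
  nonunit-classes 1F     = dec-false (p ∣? 1) p∤1
  nonunit-classes (2+ i) = refl

  φ-ℤN : φ N ≡ suc (count (not ∘ nonunit′))
  φ-ℤN = begin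
      length (filter coprime? (upTo N))
    ≡⟨ cong (length ∘ filter coprime?) (sym (upTo-∷ʳ k)) ⟩
      length (filter coprime? (upTo k ++ [ k ]))
    ≡⟨ cong length (filter-++ coprime? (upTo k) [ k ]) ⟩
      length (filter coprime? (upTo k) ++ filter coprime? [ k ])
    ≡⟨ length-++ (filter coprime? (upTo k)) ⟩
      length (filter coprime? (upTo k)) ℕ.+ length (filter coprime? [ k ])
    ≡⟨ cong₂ (λ xs ys → length xs ℕ.+ length ys) (filter-accept coprime? {x = 0} {xs = applyUpTo suc n} (gcd-zeroˡ N))
                                                       (filter-reject coprime? {x = k} {xs = []} gcd[N,N]≢1) ⟩
      suc (length (filter coprime? (applyUpTo suc n))) ℕ.+ 0
    ≡⟨ ℕP.+-identityʳ (suc (length (filter coprime? (applyUpTo suc n)))) ⟩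
      suc (length (filter coprime? (applyUpTo suc n)))
    ≡⟨ cong suc (trans (length-filter-applyUpTo coprime? n suc) (count-cong {n} (λ i → does-gcd≡1 (2 ℕ.+ toℕ i)))) ⟩
      suc (count (not ∘ nonunit′)) ∎
    where
    coprime? : Decidable (λ j → gcd (suc j) N ≡ 1)
    coprime? j = gcd (suc j) N ℕ.≟ 1
    gcd[N,N]≢1 : gcd N N ≢ 1
    gcd[N,N]≢1 gcd≡1 = p∤1 (subst (p ∣_) gcd≡1 (gcd-greatest p∣N p∣N))

  charPoly-ℤN : ∀ x → charPoly N (laplacian k) x
                        ≡ det N (twoClassMatrix (true ∷ false ∷ nonunit′) (x - + N) (x - + φ N))
  charPoly-ℤN x = det-cong N λ i j → begin
      (if does (i F.≟ j) then x else + 0) - laplacian k i j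
    ≡⟨ characteristicMatrix-ℤN x i j ⟩
      twoClassMatrix nonunit (x - + N) (x - + count (not ∘ nonunit)) i j
    ≡⟨ cong₂ (λ c d → (if c then x - + count (not ∘ nonunit) else x - + N) * δ i j + (if c ∧ d then + 0 else + 1))
             (nonunit-classes i) (nonunit-classes j) ⟩
      twoClassMatrix (true ∷ false ∷ nonunit′) (x - + N) (x - + count (not ∘ nonunit)) i j
    ≡⟨ cong (λ u → twoClassMatrix (true ∷ false ∷ nonunit′) (x - + N) (x - + u) i j)
            (trans (count-cong (λ i → cong not (nonunit-classes i))) (sym φ-ℤN)) ⟩
      twoClassMatrix (true ∷ false ∷ nonunit′) (x - + N) (x - + φ N) i j ∎

theorem3p11 : (p m k : ℕ) → Prime p → 1 < m → suc k ≡ p ^ m →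
    (x : ℤ) →
      charPoly (suc k) (laplacian k) x
        ≡ ((x - + suc k) ℤ.^ φ (suc k))
          * ((x - + φ (suc k)) ℤ.^ (suc k ∸ φ (suc k) ∸ 1))
          * x
theorem3p11 p m zero    p-prime 1<m 1≡p^m x = ⊥-elim (nonTrivial⇒≢1 {{prime⇒nonTrivial p-prime}} p≡1)
  where
  p≡1 : p ≡ 1
  p≡1 = ∣1⇒≡1 (subst (p ∣_) (sym 1≡p^m) (n∣n^e (ℕP.<⇒≤ 1<m)))
theorem3p11 p m (suc n) p-prime 1<m N≡p^m x = begin
    charPoly N (laplacian k) x
  ≡⟨ charPoly-ℤN x ⟩
    det N (twoClassMatrix (true ∷ false ∷ nonunit′) (x - + N) (x - + φ N))
  ≡⟨ cong (λ f → det N (twoClassMatrix (true ∷ false ∷ nonunit′) (x - + N) (x - + f))) φ-ℤN ⟩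
    det N (twoClassMatrix (true ∷ false ∷ nonunit′) (x - + N) (x - + suc s))
  ≡⟨ det-twoClass-spectrum n nonunit′ x ⟩
    (x - + N) ℤ.^ suc s * (x - + suc s) ℤ.^ t * x
  ≡⟨ cong₂ (λ f e → (x - + N) ℤ.^ f * (x - + f) ℤ.^ e * x) (sym φ-ℤN) (sym multiplicity) ⟩
    (x - + N) ℤ.^ φ N * (x - + φ N) ℤ.^ (N ∸ φ N ∸ 1) * x ∎
  where
  open PrimePowerModulus p-prime (ℕP.<⇒≤ 1<m) N≡p^m
  s t : ℕ
  s = count (not ∘ nonunit′)
  t = count nonunit′
  multiplicity : N ∸ φ N ∸ 1 ≡ t
  multiplicity = begin
    N ∸ φ N ∸ 1          ≡⟨ cong (λ f → N ∸ f ∸ 1) φ-ℤN ⟩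
    suc n ∸ s ∸ 1        ≡⟨ cong (λ z → suc z ∸ s ∸ 1) (sym (count-not+count n nonunit′)) ⟩
    suc (s ℕ.+ t) ∸ s ∸ 1 ≡⟨ cong (λ z → z ∸ s ∸ 1) (sym (ℕP.+-suc s t)) ⟩
    s ℕ.+ suc t ∸ s ∸ 1  ≡⟨ cong (_∸ 1) (ℕP.m+n∸m≡n s (suc t)) ⟩
    t ∎
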